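{- For every integer $n\ge1$, \[ \sum_{k=1}^{n}\delta_s(k)\,\omega(n-k)=\sum_{\substack{m+k=n\\ m\ge 1,\ k\ge 0}}\lambda(m)\sum_{j\ge0}\omega(k-jm), \] where $\lambda$ is Liouville's function ($\lambda(1)=1$, $\lambda(m)=(-1)^r$ where $r$ is the number of prime factors of $m$ counted with multiplicity) and $\delta_s(k)=1$ if $k$ is a perfect square, $0$ otherwise.
   Context: For integers $m$, $\omega(m)=1$ if $m=0$; $\omega(m)=(-1)^i$ if $m=\frac{3i^2\pm i}{2}$ for some positive integer $i$; $\omega(m)=0$ otherwise (in particular for $m<0$). -}

module Defs where

open import Data.Nat as ℕ using (ℕ; zero; suc; NonZero)
import Data.Nat.Properties as ℕP
open import Data.Nat.Primality.Factorisation using (factorise; factors)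
open import Data.Integer as ℤ using (ℤ; +_; -[1+_]; _-_)
open import Data.List using (List; []; _∷_; length; map; upTo; foldr)
open import Data.Bool using (Bool; true; false; if_then_else_; _∨_)
open import Relation.Nullary.Decidable using (⌊_⌋)

sumℤ : List ℤ → ℤ
sumℤ = foldr ℤ._+_ (+ 0)

Σ-range : ℕ → ℕ → (ℕ → ℤ) → ℤ
Σ-range a len f = sumℤ (map (λ i → f (a ℕ.+ i)) (upTo len))

signPow : ℕ → ℤ
signPow zero = + 1
signPow (suc r) = ℤ.- (signPow r)

-- Ω(m): number of prime factors of m counted with multiplicity,
-- read off the standard library's prime factorisation (unique up to permutation).
bigOmega : (m : ℕ) → .{{NonZero m}} → ℕ
bigOmega m = length (factors (factorise m))

liouville : (m : ℕ) → .{{NonZero m}} → ℤ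
liouville m = signPow (bigOmega m)

-- δ_s(k) = 1 if k is a perfect square (k = r*r for some r ∈ ℕ; necessarily r ≤ k), else 0.
isSquareB : ℕ → Bool
isSquareB k = foldr (λ r b → ⌊ r ℕ.* r ℕ.≟ k ⌋ ∨ b) false (upTo (suc k))

deltaSq : ℕ → ℤ
deltaSq k = if isSquareB k then + 1 else + 0

isPent : ℕ → ℕ → Bool
isPent m i = ⌊ 2 ℕ.* m ℕ.≟ 3 ℕ.* (i ℕ.* i) ℕ.+ i ⌋ ∨ ⌊ 2 ℕ.* m ℕ.≟ 3 ℕ.* (i ℕ.* i) ℕ.∸ i ⌋

-- search over positive i in the given list; returns (-1)^i for the first hit, else 0.
-- (For m ≥ 1 any witness i satisfies 1 ≤ i ≤ m, and the witness is unique.)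
pentSearch : ℕ → List ℕ → ℤ
pentSearch m [] = + 0
pentSearch m (i ∷ is) = if isPent m i then signPow i else pentSearch m is

-- ω(m) as in the context: 1 for m = 0, (-1)^i if m = (3i² ± i)/2 with i ≥ 1, 0 otherwise
-- (in particular 0 for m < 0).
omega : ℤ → ℤ
omega (+ zero) = + 1
omega (+ suc m) = pentSearch (suc m) (map suc (upTo (suc m)))
omega -[1+ _ ] = + 0

-- Both sides are sums of G(t) = ω(n − t) over 1 ≤ t ≤ n: the inner j-sum on the right is the sum of G
-- over the multiples t = (j + 1)m of m, so after exchanging the order of summation the right-hand side
-- is Σ_t G(t) Σ_{d ∣ t} λ(d).  No property of ω is needed beyond ω(x) = 0 for x < 0; the theorem
-- reduces to Σ_{d ∣ k} λ(d) = δ_s(k) for k ≥ 1.  For a prime p we split the divisors of mp according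
-- to whether p divides them; as λ(ep) = −λ(e), the divisor sum of mp vanishes when p ∤ m and equals
-- that of m′ when m = m′p, which is exactly how δ_s behaves, so strong induction concludes.

module Submission where

open import Defs
open import Data.Bool using (Bool; true; false; if_then_else_; _∨_)
open import Data.Bool.Properties using (T-≡; ⇔→≡; ¬-not)
open import Data.Fin using (toℕ)
open import Data.Fin.Properties using (toℕ<n)
open import Data.Integer as ℤ using (ℤ; +_; _+_; _-_; _*_; -_)
import Data.Integer.Properties as ℤP
open import Data.Integer.Tactic.RingSolver using (solve-∀)
open import Data.Bool.ListAction using (any)
open import Data.List using ([]; _∷_; applyUpTo; upTo)
open import Data.List.Membership.Propositional using (lose; find)
open import Data.List.Membership.Propositional.Properties using (∈-upTo⁺)
open import Data.List.Properties using (foldr-map; map-applyUpTo)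
open import Data.List.Relation.Binary.Permutation.Propositional.Properties using (↭-length)
open import Data.List.Relation.Unary.All using (_∷_)
open import Data.List.Relation.Unary.Any.Properties using (any⁺; any⁻)
open import Data.Nat as ℕ using (ℕ; zero; suc; _∸_; _≤_; _<_; z≤n; s≤s; NonZero; _≟_)
import Data.Nat.Properties as ℕP
open import Data.Nat.ListAction using (product)
open import Data.Nat.Coprimality using (Coprime; coprime-divisor)
open import Data.Nat.Divisibility
  using (_∣_; _∣?_; divides; ∣⇒≤; ∣-refl; ∣-trans; ∣m+n∣m⇒∣n; ∣m∣n⇒∣m+n; n∣m*n; ∣m⇒∣m*n; *-cancelʳ-∣; *-monoˡ-∣)
open import Data.Nat.Induction using (<-rec)
open import Data.Nat.Primality using (Prime; prime⇒nonZero; prime⇒irreducible; euclidsLemma; productOfPrimes≢0)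
open import Data.Nat.Primality.Factorisation using (PrimeFactorisation; factorise; factors; factorisationUnique)
import Data.Nat.Tactic.RingSolver as ℕ-Solver
open import Data.Product using (∃-syntax; _,_)
open import Data.Sum using (inj₁; inj₂; reduce)
open import Function using (_∘_; id; _⇔_; mk⇔; Equivalence)
open import Function.Construct.Composition using (_⇔-∘_)
open import Function.Construct.Symmetry using (⇔-sym)
open import Relation.Binary.PropositionalEquality
open import Relation.Nullary using (¬_; yes; no; does; contradiction)
open import Relation.Nullary.Decidable using (⌊_⌋; toWitness; fromWitness)

import Algebra.Properties.Semiring.Sum ℤP.+-*-semiring as Sum

open ≡-Reasoning

∑ : ℕ → (ℕ → ℤ) → ℤ
∑ n f = Sum.sum {n} (f ∘ toℕ)

infix 10 ∑
syntax ∑ n (λ i → e) = ∑[ i < n ] e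

∑-cong : ∀ n {f g : ℕ → ℤ} → (∀ i → i < n → f i ≡ g i) → ∑ n f ≡ ∑ n g
∑-cong n f≗g = Sum.sum-cong-≗ (λ i → f≗g (toℕ i) (toℕ<n i))

∑-zero : ∀ n {f : ℕ → ℤ} → (∀ i → i < n → f i ≡ + 0) → ∑ n f ≡ + 0
∑-zero n f≗0 = trans (∑-cong n f≗0) (Sum.sum-replicate-zero n)

∑-neg : ∀ n (f : ℕ → ℤ) → ∑[ i < n ] (- f i) ≡ - ∑ n f
∑-neg zero    f = refl
∑-neg (suc n) f = trans (cong (_+_ (- f 0)) (∑-neg n (f ∘ suc))) (sym (ℤP.neg-distrib-+ (f 0) _))

∑-distrib-+ : ∀ n (f g : ℕ → ℤ) → ∑[ i < n ] (f i + g i) ≡ ∑ n f + ∑ n g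
∑-distrib-+ n f g = Sum.∑-distrib-+ {n} (f ∘ toℕ) (g ∘ toℕ)

*-distribˡ-∑ : ∀ n c (f : ℕ → ℤ) → c * ∑ n f ≡ ∑[ i < n ] (c * f i)
*-distribˡ-∑ n c f = Sum.*-distribˡ-sum {n} c (f ∘ toℕ)

*-distribʳ-∑ : ∀ n c (f : ℕ → ℤ) → ∑ n f * c ≡ ∑[ i < n ] (f i * c)
*-distribʳ-∑ n c f = Sum.*-distribʳ-sum {n} c (f ∘ toℕ)

∑-comm : ∀ m n (f : ℕ → ℕ → ℤ) → ∑[ i < m ] ∑[ j < n ] f i j ≡ ∑[ j < n ] ∑[ i < m ] f i j
∑-comm m n f = Sum.∑-comm {m} {n} (λ i j → f (toℕ i) (toℕ j))

∑-split : ∀ m n (f : ℕ → ℤ) → ∑ (m ℕ.+ n) f ≡ ∑ m f + ∑[ i < n ] f (m ℕ.+ i)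
∑-split zero    n f = sym (ℤP.+-identityˡ _)
∑-split (suc m) n f = trans (cong (_+_ (f 0)) (∑-split m n (f ∘ suc))) (sym (ℤP.+-assoc (f 0) _ _))

∑-last : ∀ n (f : ℕ → ℤ) → ∑ (suc n) f ≡ ∑ n f + f n
∑-last zero    f = trans (ℤP.+-identityʳ (f 0)) (sym (ℤP.+-identityˡ (f 0)))
∑-last (suc n) f = trans (cong (_+_ (f 0)) (∑-last n (f ∘ suc))) (sym (ℤP.+-assoc (f 0) _ _))

∑-extend : ∀ {m n} (f : ℕ → ℤ) → m ≤ n → (∀ i → m ≤ i → i < n → f i ≡ + 0) → ∑ n f ≡ ∑ m f
∑-extend {m} {n} f m≤n tail≗0 = begin
  ∑ n f                                     ≡⟨ cong (λ k → ∑ k f) (ℕP.m+[n∸m]≡n m≤n) ⟨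
  ∑ (m ℕ.+ (n ∸ m)) f                       ≡⟨ ∑-split m (n ∸ m) f ⟩
  ∑ m f + ∑[ i < n ∸ m ] f (m ℕ.+ i)        ≡⟨ cong (_+_ (∑ m f)) (∑-zero (n ∸ m) tail-zero) ⟩
  ∑ m f + + 0                               ≡⟨ ℤP.+-identityʳ _ ⟩
  ∑ m f                                     ∎
  where
  tail-zero : ∀ i → i < n ∸ m → f (m ℕ.+ i) ≡ + 0
  tail-zero i i<n∸m = tail≗0 (m ℕ.+ i) (ℕP.m≤m+n m i) (subst (m ℕ.+ i <_) (ℕP.m+[n∸m]≡n m≤n) (ℕP.+-monoʳ-< m i<n∸m))

sumℤ-applyUpTo : ∀ n (f : ℕ → ℤ) → sumℤ (applyUpTo f n) ≡ ∑ n f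
sumℤ-applyUpTo zero    f = refl
sumℤ-applyUpTo (suc n) f = cong (_+_ (f 0)) (sumℤ-applyUpTo n (f ∘ suc))

Σ-range≡∑ : ∀ a n (f : ℕ → ℤ) → Σ-range a n f ≡ ∑[ i < n ] f (a ℕ.+ i)
Σ-range≡∑ a n f = trans (cong sumℤ (map-applyUpTo id _ n)) (sumℤ-applyUpTo n _)

-- Opaque, since once unfolded inside ℤ's _*_ it blocks the inference of implicit summands.
opaque
  𝟙[_∣_] : ℕ → ℕ → ℤ
  𝟙[ d ∣ k ] = if does (d ∣? k) then + 1 else + 0

  𝟙-∣ : ∀ {d k} → d ∣ k → 𝟙[ d ∣ k ] ≡ + 1
  𝟙-∣ {d} {k} d∣k with d ∣? k
  ... | yes _   = refl
  ... | no  d∤k = contradiction d∣k d∤k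

  𝟙-∤ : ∀ {d k} → ¬ d ∣ k → 𝟙[ d ∣ k ] ≡ + 0
  𝟙-∤ {d} {k} d∤k with d ∣? k
  ... | yes d∣k = contradiction d∣k d∤k
  ... | no  _   = refl

  𝟙-cong : ∀ {d k d′ k′} → d ∣ k ⇔ d′ ∣ k′ → 𝟙[ d ∣ k ] ≡ 𝟙[ d′ ∣ k′ ]
  𝟙-cong {d} {k} d∣k⇔d′∣k′ with d ∣? k
  ... | yes d∣k = sym (𝟙-∣ (Equivalence.to d∣k⇔d′∣k′ d∣k))
  ... | no  d∤k = sym (𝟙-∤ (d∤k ∘ Equivalence.from d∣k⇔d′∣k′))

𝟙-+-cancelˡ : ∀ p {n} → 𝟙[ p ∣ p ℕ.+ n ] ≡ 𝟙[ p ∣ n ]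
𝟙-+-cancelˡ p = 𝟙-cong (mk⇔ (λ p∣p+n → ∣m+n∣m⇒∣n p∣p+n ∣-refl) (∣m∣n⇒∣m+n ∣-refl))

𝟙-*-cancelʳ : ∀ o .{{_ : NonZero o}} {d k} → 𝟙[ d ℕ.* o ∣ k ℕ.* o ] ≡ 𝟙[ d ∣ k ]
𝟙-*-cancelʳ o = 𝟙-cong (mk⇔ (*-cancelʳ-∣ o) (*-monoˡ-∣ o))

∑-multiples-block : ∀ p .{{_ : NonZero p}} (G : ℕ → ℤ) → ∑[ i < p ] (𝟙[ p ∣ suc i ] * G (suc i)) ≡ G p
∑-multiples-block (suc p) G = begin
  ∑[ i < suc p ] (𝟙[ suc p ∣ suc i ] * G (suc i))            ≡⟨ ∑-last p (λ i → 𝟙[ suc p ∣ suc i ] * G (suc i)) ⟩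
  ∑[ i < p ] (𝟙[ suc p ∣ suc i ] * G (suc i)) + 𝟙[ suc p ∣ suc p ] * G (suc p)
    ≡⟨ cong₂ _+_ (∑-zero p (λ i i<p → cong (_* G (suc i)) (𝟙-∤ (ℕP.<⇒≱ (s≤s i<p) ∘ ∣⇒≤))))
                 (cong (_* G (suc p)) (𝟙-∣ ∣-refl)) ⟩
  + 0 * G (suc p) + + 1 * G (suc p)                            ≡⟨ cong (_+_ (+ 0)) (ℤP.*-identityˡ (G (suc p))) ⟩
  + 0 + G (suc p)                                              ≡⟨ ℤP.+-identityˡ _ ⟩
  G (suc p)                                                    ∎

∑-multiples : ∀ p .{{_ : NonZero p}} L (G : ℕ → ℤ) →
  ∑[ i < L ℕ.* p ] (𝟙[ p ∣ suc i ] * G (suc i)) ≡ ∑[ j < L ] G (suc j ℕ.* p)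
∑-multiples p zero    G = refl
∑-multiples p (suc L) G = begin
  ∑[ i < p ℕ.+ L ℕ.* p ] (𝟙[ p ∣ suc i ] * G (suc i))
    ≡⟨ ∑-split p (L ℕ.* p) (λ i → 𝟙[ p ∣ suc i ] * G (suc i)) ⟩
  ∑[ i < p ] (𝟙[ p ∣ suc i ] * G (suc i)) + ∑[ i < L ℕ.* p ] (𝟙[ p ∣ suc (p ℕ.+ i) ] * G (suc (p ℕ.+ i)))
    ≡⟨ cong₂ _+_ (∑-multiples-block p G) (∑-cong (L ℕ.* p) (λ i _ → shift i)) ⟩
  G p + ∑[ i < L ℕ.* p ] (𝟙[ p ∣ suc i ] * G (p ℕ.+ suc i))
    ≡⟨ cong₂ _+_ (sym (cong G (ℕP.+-identityʳ p))) (∑-multiples p L (G ∘ (p ℕ.+_))) ⟩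
  G (suc zero ℕ.* p) + ∑[ j < L ] G (suc (suc j) ℕ.* p) ∎
  where
  shift : ∀ i → 𝟙[ p ∣ suc (p ℕ.+ i) ] * G (suc (p ℕ.+ i)) ≡ 𝟙[ p ∣ suc i ] * G (p ℕ.+ suc i)
  shift i = cong₂ _*_ (trans (cong 𝟙[ p ∣_] (sym (ℕP.+-suc p i))) (𝟙-+-cancelˡ p)) (cong G (sym (ℕP.+-suc p i)))

∑-multiples-vanishing : ∀ {N} m .{{_ : NonZero m}} L (G : ℕ → ℤ) → N ≤ L ℕ.* m → (∀ t → N < t → G t ≡ + 0) →
  ∑[ t < N ] (𝟙[ m ∣ suc t ] * G (suc t)) ≡ ∑[ j < L ] G (suc j ℕ.* m)
∑-multiples-vanishing m L G N≤Lm G-vanishes = trans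
  (sym (∑-extend _ N≤Lm
    (λ t N≤t _ → trans (cong (𝟙[ m ∣ suc t ] *_) (G-vanishes (suc t) (s≤s N≤t))) (ℤP.*-zeroʳ 𝟙[ m ∣ suc t ]))))
  (∑-multiples m L G)

-- d ranges over 1, …, N; d = 0 is left out, which matters only for k = 0.
∑∣ : ℕ → ℕ → (ℕ → ℤ) → ℤ
∑∣ N k f = ∑[ i < N ] (𝟙[ suc i ∣ k ] * f (suc i))

infix 10 ∑∣
syntax ∑∣ N k (λ d → e) = ∑[ d ≤ N ∣ k ] e

∑∣-bound : ∀ {N k} .{{_ : NonZero k}} (f : ℕ → ℤ) → k ≤ N → ∑[ d ≤ N ∣ k ] f d ≡ ∑[ d ≤ k ∣ k ] f d
∑∣-bound {k = k} f k≤N = ∑-extend _ k≤N non-divisor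
  where
  non-divisor : ∀ i → k ≤ i → i < _ → 𝟙[ suc i ∣ k ] * f (suc i) ≡ + 0
  non-divisor i k≤i _ = trans (cong (_* f (suc i)) (𝟙-∤ (ℕP.<⇒≱ (s≤s k≤i) ∘ ∣⇒≤))) (ℤP.*-zeroˡ (f (suc i)))

∑∣-cong : ∀ N k {f g : ℕ → ℤ} → (∀ d → f (suc d) ≡ g (suc d)) → ∑[ d ≤ N ∣ k ] f d ≡ ∑[ d ≤ N ∣ k ] g d
∑∣-cong N k f≗g = ∑-cong N (λ i _ → cong (𝟙[ suc i ∣ k ] *_) (f≗g i))

∑∣-neg : ∀ N k (f : ℕ → ℤ) → ∑[ d ≤ N ∣ k ] (- f d) ≡ - ∑[ d ≤ N ∣ k ] f d
∑∣-neg N k f = begin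
  ∑[ i < N ] (𝟙[ suc i ∣ k ] * - f (suc i))     ≡⟨ ∑-cong N (λ i _ → ℤP.neg-distribʳ-* 𝟙[ suc i ∣ k ] (f (suc i))) ⟨
  ∑[ i < N ] (- (𝟙[ suc i ∣ k ] * f (suc i)))   ≡⟨ ∑-neg N (λ i → 𝟙[ suc i ∣ k ] * f (suc i)) ⟩
  - ∑[ d ≤ N ∣ k ] f d                           ∎

∑-∑∣-comm : ∀ N (f g : ℕ → ℤ) →
  ∑[ t < N ] (∑[ d ≤ N ∣ suc t ] f d * g (suc t))
    ≡ ∑[ i < N ] (f (suc i) * ∑[ t < N ] (𝟙[ suc i ∣ suc t ] * g (suc t)))
∑-∑∣-comm N f g = begin
  ∑[ t < N ] (∑[ d ≤ N ∣ suc t ] f d * g (suc t))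
    ≡⟨ ∑-cong N (λ t _ → *-distribʳ-∑ N (g (suc t)) (λ i → 𝟙[ suc i ∣ suc t ] * f (suc i))) ⟩
  ∑[ t < N ] ∑[ i < N ] (𝟙[ suc i ∣ suc t ] * f (suc i) * g (suc t))
    ≡⟨ ∑-cong N (λ t _ → ∑-cong N (λ i _ → reassoc 𝟙[ suc i ∣ suc t ] (f (suc i)) (g (suc t)))) ⟩
  ∑[ t < N ] ∑[ i < N ] (f (suc i) * (𝟙[ suc i ∣ suc t ] * g (suc t)))
    ≡⟨ ∑-comm N N (λ t i → f (suc i) * (𝟙[ suc i ∣ suc t ] * g (suc t))) ⟩
  ∑[ i < N ] ∑[ t < N ] (f (suc i) * (𝟙[ suc i ∣ suc t ] * g (suc t)))
    ≡⟨ ∑-cong N (λ i _ → *-distribˡ-∑ N (f (suc i)) (λ t → 𝟙[ suc i ∣ suc t ] * g (suc t))) ⟨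
  ∑[ i < N ] (f (suc i) * ∑[ t < N ] (𝟙[ suc i ∣ suc t ] * g (suc t))) ∎
  where
  reassoc : ∀ a b c → a * b * c ≡ b * (a * c)
  reassoc = solve-∀

IsSquare : ℕ → Set
IsSquare k = ∃[ r ] r ℕ.* r ≡ k

n≤n*n : ∀ n → n ≤ n ℕ.* n
n≤n*n zero        = z≤n
n≤n*n n@(suc _)   = ℕP.m≤m*n n n

isSquareB-correct : ∀ k → isSquareB k ≡ true ⇔ IsSquare k
isSquareB-correct k = mk⇔ sound complete
  where
  square? : ℕ → Bool
  square? r = ⌊ r ℕ.* r ≟ k ⌋

  isSquareB≡any : isSquareB k ≡ any square? (upTo (suc k))
  isSquareB≡any = sym (foldr-map _∨_ square? false (upTo (suc k)))

  sound : isSquareB k ≡ true → IsSquare k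
  sound isSq with r , _ , r²≡k ← find (any⁻ square? (upTo (suc k)) (Equivalence.from T-≡ (trans (sym isSquareB≡any) isSq)))
    = r , toWitness r²≡k

  complete : IsSquare k → isSquareB k ≡ true
  complete (r , r²≡k) = trans isSquareB≡any (Equivalence.to T-≡ (any⁺ {xs = upTo (suc k)} square? (lose r∈upTo (fromWitness r²≡k))))
    where
    r∈upTo = ∈-upTo⁺ (s≤s (subst (r ≤_) r²≡k (n≤n*n r)))

deltaSq-cong : ∀ {k k′} → IsSquare k ⇔ IsSquare k′ → deltaSq k ≡ deltaSq k′
deltaSq-cong {k} {k′} k⇔k′ = cong (λ b → if b then + 1 else + 0)
  (⇔→≡ (⇔-sym (isSquareB-correct k′) ⇔-∘ (k⇔k′ ⇔-∘ isSquareB-correct k)))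

deltaSq-nonsquare : ∀ {k} → ¬ IsSquare k → deltaSq k ≡ + 0
deltaSq-nonsquare {k} ¬square = cong (λ b → if b then + 1 else + 0)
  (¬-not (¬square ∘ Equivalence.to (isSquareB-correct k)))

*-square : ∀ a b → a ℕ.* b ℕ.* (a ℕ.* b) ≡ a ℕ.* a ℕ.* b ℕ.* b
*-square = ℕ-Solver.solve-∀

-- λ extended by λ(0) = 0 so that it can be summed over ℕ-indexed ranges; the value at 0 is never used.
liouville₀ : ℕ → ℤ
liouville₀ zero    = + 0
liouville₀ (suc m) = liouville (suc m)

liouville₀-nonZero : ∀ m .{{_ : NonZero m}} → liouville₀ m ≡ liouville m
liouville₀-nonZero (suc m) = refl

module _ {p} (p-prime : Prime p) where

  private instance
    p≢0 : NonZero p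
    p≢0 = prime⇒nonZero p-prime

  ∤-prime⇒coprime : ∀ {d} → ¬ p ∣ d → Coprime d p
  ∤-prime⇒coprime p∤d (c∣d , c∣p) with prime⇒irreducible p-prime c∣p
  ... | inj₁ c≡1    = c≡1
  ... | inj₂ refl   = contradiction c∣d p∤d

  𝟙-∣-*prime : ∀ {d m} → ¬ p ∣ d → 𝟙[ d ∣ m ℕ.* p ] ≡ 𝟙[ d ∣ m ]
  𝟙-∣-*prime {d} {m} p∤d = 𝟙-cong (mk⇔
    (λ d∣mp → coprime-divisor (∤-prime⇒coprime p∤d) (subst (d ∣_) (ℕP.*-comm m p) d∣mp))
    (∣m⇒∣m*n p))

  -- A divisor d of mp with p ∤ d divides m, and one with p ∣ d is ep for some e ∣ m.
  ∑∣-split : ∀ m (f : ℕ → ℤ) →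
    ∑[ d ≤ m ℕ.* p ∣ m ℕ.* p ] f d + ∑[ e < m ] (𝟙[ suc e ℕ.* p ∣ m ] * f (suc e ℕ.* p))
      ≡ ∑[ d ≤ m ℕ.* p ∣ m ] f d + ∑[ e ≤ m ∣ m ] f (e ℕ.* p)
  ∑∣-split m f = begin
    ∑∣ M M f + ∑[ e < m ] (𝟙[ suc e ℕ.* p ∣ m ] * f (suc e ℕ.* p))
      ≡⟨ cong (_+_ (∑∣ M M f)) (∑-multiples p m (λ d → 𝟙[ d ∣ m ] * f d)) ⟨
    ∑∣ M M f + ∑[ i < M ] (𝟙[ p ∣ suc i ] * (𝟙[ suc i ∣ m ] * f (suc i)))
      ≡⟨ ∑-distrib-+ M (λ i → 𝟙[ suc i ∣ M ] * f (suc i)) (λ i → 𝟙[ p ∣ suc i ] * (𝟙[ suc i ∣ m ] * f (suc i))) ⟨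
    ∑[ i < M ] (𝟙[ suc i ∣ M ] * f (suc i) + 𝟙[ p ∣ suc i ] * (𝟙[ suc i ∣ m ] * f (suc i)))
      ≡⟨ ∑-cong M (λ i _ → split-by-p (suc i)) ⟩
    ∑[ i < M ] (𝟙[ suc i ∣ m ] * f (suc i) + 𝟙[ p ∣ suc i ] * (𝟙[ suc i ∣ M ] * f (suc i)))
      ≡⟨ ∑-distrib-+ M (λ i → 𝟙[ suc i ∣ m ] * f (suc i)) (λ i → 𝟙[ p ∣ suc i ] * (𝟙[ suc i ∣ M ] * f (suc i))) ⟩
    ∑∣ M m f + ∑[ i < M ] (𝟙[ p ∣ suc i ] * (𝟙[ suc i ∣ M ] * f (suc i)))
      ≡⟨ cong (_+_ (∑∣ M m f)) (∑-multiples p m (λ d → 𝟙[ d ∣ M ] * f d)) ⟩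
    ∑∣ M m f + ∑[ e < m ] (𝟙[ suc e ℕ.* p ∣ M ] * f (suc e ℕ.* p))
      ≡⟨ cong (_+_ (∑∣ M m f)) (∑-cong m (λ e _ → cong (_* f (suc e ℕ.* p)) (𝟙-*-cancelʳ p {suc e}))) ⟩
    ∑∣ M m f + ∑[ e ≤ m ∣ m ] f (e ℕ.* p) ∎
    where
    M = m ℕ.* p

    split-by-p : ∀ d → 𝟙[ d ∣ M ] * f d + 𝟙[ p ∣ d ] * (𝟙[ d ∣ m ] * f d)
                     ≡ 𝟙[ d ∣ m ] * f d + 𝟙[ p ∣ d ] * (𝟙[ d ∣ M ] * f d)
    split-by-p d with p ∣? d
    ... | yes p∣d rewrite 𝟙-∣ p∣d = swap (𝟙[ d ∣ M ] * f d) (𝟙[ d ∣ m ] * f d)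
      where
      swap : ∀ a b → a + + 1 * b ≡ b + + 1 * a
      swap = solve-∀
    ... | no  p∤d rewrite 𝟙-∤ p∤d | 𝟙-∣-*prime {d} {m} p∤d = refl

  bigOmega-*prime : ∀ m .{{_ : NonZero m}} → bigOmega (m ℕ.* p) {{ℕP.m*n≢0 m p}} ≡ suc (bigOmega m)
  bigOmega-*prime m = ↭-length (factorisationUnique (factorise (m ℕ.* p) {{ℕP.m*n≢0 m p}}) mp-factorisation)
    where
    mp-factorisation : PrimeFactorisation (m ℕ.* p)
    mp-factorisation = record
      { factors         = p ∷ factors (factorise m)
      ; isFactorisation = trans (ℕP.*-comm m p) (cong (p ℕ.*_) (PrimeFactorisation.isFactorisation (factorise m)))
      ; factorsPrime    = p-prime ∷ PrimeFactorisation.factorsPrime (factorise m)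
      }

  liouville₀-*prime : ∀ m → liouville₀ (m ℕ.* p) ≡ - liouville₀ m
  liouville₀-*prime zero      = refl
  liouville₀-*prime m@(suc _) =
    trans (liouville₀-nonZero (m ℕ.* p) {{ℕP.m*n≢0 m p}}) (cong signPow (bigOmega-*prime m))

  ∑∣-liouville₀-*prime : ∀ m .{{_ : NonZero m}} →
    ∑[ d ≤ m ℕ.* p ∣ m ℕ.* p ] liouville₀ d ≡ - ∑[ e < m ] (𝟙[ suc e ℕ.* p ∣ m ] * liouville₀ (suc e ℕ.* p))
  ∑∣-liouville₀-*prime m = begin
    S                                                           ≡⟨ add-sub S R ⟩
    S + R + - R                                                 ≡⟨ cong (_+ - R) (∑∣-split m liouville₀) ⟩
    ∑[ d ≤ m ℕ.* p ∣ m ] liouville₀ d + ∑[ e ≤ m ∣ m ] liouville₀ (e ℕ.* p) + - R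
      ≡⟨ cong (_+ - R) (cong₂ _+_ (∑∣-bound liouville₀ (ℕP.m≤m*n m p)) twisted) ⟩
    ∑[ d ≤ m ∣ m ] liouville₀ d + - ∑[ d ≤ m ∣ m ] liouville₀ d + - R  ≡⟨ cancel (∑[ d ≤ m ∣ m ] liouville₀ d) R ⟩
    - R                                                         ∎
    where
    S = ∑[ d ≤ m ℕ.* p ∣ m ℕ.* p ] liouville₀ d
    R = ∑[ e < m ] (𝟙[ suc e ℕ.* p ∣ m ] * liouville₀ (suc e ℕ.* p))

    twisted : ∑[ e ≤ m ∣ m ] liouville₀ (e ℕ.* p) ≡ - ∑[ d ≤ m ∣ m ] liouville₀ d
    twisted = trans (∑∣-cong m m {λ e → liouville₀ (e ℕ.* p)} {λ d → - liouville₀ d} (liouville₀-*prime ∘ suc)) (∑∣-neg m m liouville₀)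

    add-sub : ∀ a b → a ≡ a + b + - b
    add-sub = solve-∀
    cancel : ∀ a b → a + - a + - b ≡ - b
    cancel = solve-∀

  ∑∣-liouville₀-*prime-∤ : ∀ m .{{_ : NonZero m}} → ¬ p ∣ m → ∑[ d ≤ m ℕ.* p ∣ m ℕ.* p ] liouville₀ d ≡ + 0
  ∑∣-liouville₀-*prime-∤ m p∤m = trans (∑∣-liouville₀-*prime m) (cong -_ (∑-zero m no-multiple))
    where
    no-multiple : ∀ e → e < m → 𝟙[ suc e ℕ.* p ∣ m ] * liouville₀ (suc e ℕ.* p) ≡ + 0
    no-multiple e _ = trans (cong (_* liouville₀ (suc e ℕ.* p)) (𝟙-∤ (p∤m ∘ ∣-trans (n∣m*n (suc e)))))
                            (ℤP.*-zeroˡ (liouville₀ (suc e ℕ.* p)))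

  ∑∣-liouville₀-*prime² : ∀ m .{{_ : NonZero m}} →
    ∑[ d ≤ m ℕ.* p ℕ.* p ∣ m ℕ.* p ℕ.* p ] liouville₀ d ≡ ∑[ d ≤ m ∣ m ] liouville₀ d
  ∑∣-liouville₀-*prime² m = begin
    ∑[ d ≤ M ℕ.* p ∣ M ℕ.* p ] liouville₀ d
      ≡⟨ ∑∣-liouville₀-*prime M {{ℕP.m*n≢0 m p}} ⟩
    - ∑[ e < M ] (𝟙[ suc e ℕ.* p ∣ M ] * liouville₀ (suc e ℕ.* p))
      ≡⟨ cong -_ (∑-cong M (λ e _ → cong₂ _*_ (𝟙-*-cancelʳ p {suc e}) (liouville₀-*prime (suc e)))) ⟩
    - ∑[ d ≤ M ∣ m ] (- liouville₀ d)       ≡⟨ cong -_ (∑∣-neg M m liouville₀) ⟩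
    - - ∑[ d ≤ M ∣ m ] liouville₀ d         ≡⟨ ℤP.neg-involutive _ ⟩
    ∑[ d ≤ M ∣ m ] liouville₀ d             ≡⟨ ∑∣-bound liouville₀ (ℕP.m≤m*n m p) ⟩
    ∑[ d ≤ m ∣ m ] liouville₀ d             ∎
    where
    M = m ℕ.* p

  prime∣square⇒∣ : ∀ {r} → p ∣ r ℕ.* r → p ∣ r
  prime∣square⇒∣ {r} p∣r² = reduce (euclidsLemma r r p-prime p∣r²)

  isSquare-*prime² : ∀ {m} → IsSquare (m ℕ.* p ℕ.* p) ⇔ IsSquare m
  isSquare-*prime² {m} = mk⇔ root (λ { (r , refl) → r ℕ.* p , *-square r p })
    where
    root : IsSquare (m ℕ.* p ℕ.* p) → IsSquare m
    root (r , r²≡mpp) with divides q refl ← prime∣square⇒∣ {r} (subst (p ∣_) (sym r²≡mpp) (n∣m*n (m ℕ.* p)))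
      = q , ℕP.*-cancelʳ-≡ _ _ p (ℕP.*-cancelʳ-≡ _ _ p (trans (sym (*-square q p)) r²≡mpp))

  ¬isSquare-*prime : ∀ {m} → ¬ p ∣ m → ¬ IsSquare (m ℕ.* p)
  ¬isSquare-*prime {m} p∤m (r , r²≡mp) with divides q refl ← prime∣square⇒∣ {r} (subst (p ∣_) (sym r²≡mp) (n∣m*n m))
    = p∤m (divides (q ℕ.* q) (sym (ℕP.*-cancelʳ-≡ _ _ p (trans (sym (*-square q p)) r²≡mp))))

  ∑∣-liouville₀≡deltaSq-*prime : ∀ m .{{_ : NonZero m}} →
    (∀ {j} → j < m ℕ.* p → .{{_ : NonZero j}} → ∑[ d ≤ j ∣ j ] liouville₀ d ≡ deltaSq j) →
    ∑[ d ≤ m ℕ.* p ∣ m ℕ.* p ] liouville₀ d ≡ deltaSq (m ℕ.* p)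
  ∑∣-liouville₀≡deltaSq-*prime m ih with p ∣? m
  ... | no p∤m = trans (∑∣-liouville₀-*prime-∤ m p∤m) (sym (deltaSq-nonsquare (¬isSquare-*prime p∤m)))
  ... | yes (divides q refl) = begin
    ∑[ d ≤ q ℕ.* p ℕ.* p ∣ q ℕ.* p ℕ.* p ] liouville₀ d  ≡⟨ ∑∣-liouville₀-*prime² q ⟩
    ∑[ d ≤ q ∣ q ] liouville₀ d                        ≡⟨ ih q<qpp ⟩
    deltaSq q                                          ≡⟨ deltaSq-cong (isSquare-*prime² {q}) ⟨
    deltaSq (q ℕ.* p ℕ.* p)                            ∎
    where
    instance
      q≢0 : NonZero q
      q≢0 = ℕP.m*n≢0⇒m≢0 q
    q<qpp : q < q ℕ.* p ℕ.* p
    q<qpp = ℕP.<-≤-trans (ℕP.m<m*n q p (ℕ.nonTrivial⇒n>1 p)) (ℕP.m≤m*n (q ℕ.* p) p)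

∑∣-liouville₀≡deltaSq : ∀ k .{{_ : NonZero k}} → ∑[ d ≤ k ∣ k ] liouville₀ d ≡ deltaSq k
∑∣-liouville₀≡deltaSq = <-rec P step
  where
  P : ℕ → Set
  P k = .{{_ : NonZero k}} → ∑[ d ≤ k ∣ k ] liouville₀ d ≡ deltaSq k

  step : ∀ k → (∀ {j} → j < k → P j) → P k
  step k ih with factorise k
  ... | record { factors = [] ; isFactorisation = refl } = cong (λ x → x * liouville₀ 1 + + 0) (𝟙-∣ ∣-refl)
  ... | record { factors = p ∷ ps ; isFactorisation = refl ; factorsPrime = p-prime ∷ ps-prime } =
    subst (λ n → ∑[ d ≤ n ∣ n ] liouville₀ d ≡ deltaSq n) (ℕP.*-comm (product ps) p)
      (∑∣-liouville₀≡deltaSq-*prime p-prime (product ps) {{productOfPrimes≢0 ps-prime}}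
        (λ {j} j<mp → ih (subst (j <_) (ℕP.*-comm (product ps) p) j<mp)))

pos-∸ : ∀ {m n} → n ≤ m → + (m ∸ n) ≡ + m - + n
pos-∸ {m} {n} n≤m = sym (trans (ℤP.m-n≡m⊖n m n) (ℤP.⊖-≥ n≤m))

omega-negative : ∀ {m n} → m < n → omega (+ m - + n) ≡ + 0
omega-negative {m} {n} m<n = trans (cong omega (trans (ℤP.m-n≡m⊖n m n) (ℤP.⊖-< m<n))) (omega-neg (ℕP.m<n⇒0<n∸m m<n))
  where
  omega-neg : ∀ {x} → 0 < x → omega (- + x) ≡ + 0
  omega-neg {suc _} _ = refl

n≤[1+n∸m]*m : ∀ {m n} .{{_ : NonZero m}} → m ≤ n → n ≤ suc (n ∸ m) ℕ.* m
n≤[1+n∸m]*m {m} {n} m≤n =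
  ℕP.≤-trans (ℕP.≤-reflexive (sym (ℕP.m+[n∸m]≡n m≤n))) (ℕP.+-monoʳ-≤ m (ℕP.m≤m*n (n ∸ m) m))

Σ-range-omega≡∑-multiples : ∀ n m .{{_ : NonZero m}} → m ≤ n →
  Σ-range 0 (suc (n ∸ m)) (λ j → omega (+ (n ∸ m) - + (j ℕ.* m)))
    ≡ ∑[ t < n ] (𝟙[ m ∣ suc t ] * omega (+ n - + suc t))
Σ-range-omega≡∑-multiples n m m≤n = begin
  Σ-range 0 (suc (n ∸ m)) (λ j → omega (+ (n ∸ m) - + (j ℕ.* m)))
    ≡⟨ Σ-range≡∑ 0 (suc (n ∸ m)) (λ j → omega (+ (n ∸ m) - + (j ℕ.* m))) ⟩
  ∑[ j < suc (n ∸ m) ] omega (+ (n ∸ m) - + (j ℕ.* m))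
    ≡⟨ ∑-cong (suc (n ∸ m)) (λ j _ → cong omega (shift j)) ⟩
  ∑[ j < suc (n ∸ m) ] G (suc j ℕ.* m)
    ≡⟨ ∑-multiples-vanishing m (suc (n ∸ m)) G (n≤[1+n∸m]*m m≤n) (λ _ → omega-negative) ⟨
  ∑[ t < n ] (𝟙[ m ∣ suc t ] * G (suc t)) ∎
  where
  G : ℕ → ℤ
  G t = omega (+ n - + t)

  shift : ∀ j → + (n ∸ m) - + (j ℕ.* m) ≡ + n - + (suc j ℕ.* m)
  shift j = begin
    + (n ∸ m) - + (j ℕ.* m)      ≡⟨ cong (_- + (j ℕ.* m)) (pos-∸ m≤n) ⟩
    + n - + m - + (j ℕ.* m)      ≡⟨ sub-sub (+ n) (+ m) (+ (j ℕ.* m)) ⟩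
    + n - (+ m + + (j ℕ.* m))    ≡⟨ cong (λ x → + n - x) (ℤP.pos-+ m (j ℕ.* m)) ⟨
    + n - + (suc j ℕ.* m)        ∎
    where
    sub-sub : ∀ a b c → a - b - c ≡ a - (b + c)
    sub-sub = solve-∀

mainTheorem10 : (n : ℕ) → 1 ℕ.≤ n →
    Σ-range 1 n (λ k → deltaSq k * omega (+ (n ∸ k)))
      ≡ Σ-range 0 n (λ i → liouville (suc i)
          * Σ-range 0 (suc (n ∸ suc i)) (λ j → omega (+ (n ∸ suc i) - + (j ℕ.* suc i))))
mainTheorem10 n _ = begin
  Σ-range 1 n (λ k → deltaSq k * omega (+ (n ∸ k)))
    ≡⟨ Σ-range≡∑ 1 n (λ k → deltaSq k * omega (+ (n ∸ k))) ⟩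
  ∑[ t < n ] (deltaSq (suc t) * omega (+ (n ∸ suc t)))
    ≡⟨ ∑-cong n (λ t t<n → cong₂ _*_ (divisor-sum t<n) (cong omega (pos-∸ t<n))) ⟩
  ∑[ t < n ] (∑[ d ≤ n ∣ suc t ] liouville₀ d * G (suc t))
    ≡⟨ ∑-∑∣-comm n liouville₀ G ⟩
  ∑[ i < n ] (liouville (suc i) * ∑[ t < n ] (𝟙[ suc i ∣ suc t ] * G (suc t)))
    ≡⟨ ∑-cong n (λ i i<n → cong (liouville (suc i) *_) (Σ-range-omega≡∑-multiples n (suc i) i<n)) ⟨
  ∑[ i < n ] (liouville (suc i) * Σ-range 0 (suc (n ∸ suc i)) (λ j → omega (+ (n ∸ suc i) - + (j ℕ.* suc i))))
    ≡⟨ Σ-range≡∑ 0 n (λ i → liouville (suc i)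
         * Σ-range 0 (suc (n ∸ suc i)) (λ j → omega (+ (n ∸ suc i) - + (j ℕ.* suc i)))) ⟨
  Σ-range 0 n (λ i → liouville (suc i)
    * Σ-range 0 (suc (n ∸ suc i)) (λ j → omega (+ (n ∸ suc i) - + (j ℕ.* suc i)))) ∎
  where
  G : ℕ → ℤ
  G t = omega (+ n - + t)

  divisor-sum : ∀ {t} → suc t ≤ n → deltaSq (suc t) ≡ ∑[ d ≤ n ∣ suc t ] liouville₀ d
  divisor-sum {t} t<n = sym (trans (∑∣-bound liouville₀ t<n) (∑∣-liouville₀≡deltaSq (suc t)))
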